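{- Let $a,b,k$ be integers with $a\neq 0$, $|a|\ne 1$ and $\gcd(a,b)=1$. Then $$(a^{ -1})_{k\,a+b}=k\big(a-(b^{ -1})_{a}\big)+(a^{ -1})_{b}, \qquad (a^{ -1})_{k\,a-b}=k\,(b^{ -1})_{a}-\big(b-(a^{ -1})_{b}\big).$$
   Context: For nonzero integers $a, m$ with $\gcd(a,m)=1$, the modular inverse $(a^{ -1})_m$ is the integer $x$ defined as follows: if $m>1$, $x$ is the unique integer with $1\le x\le m-1$ and $ax\equiv 1 \pmod m$; if $m<-1$, $x$ is the unique integer with $m+1\le x\le -1$ and $ax\equiv 1\pmod m$; if $|m|=1$, $x=\tfrac12|m|(\operatorname{sgn}(m)-\operatorname{sgn}(a))+\operatorname{sgn}(a)$. $(a^{ -1})_m$ is undefined if $am=0$ or $\gcd(a,m)\ne1$. -}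

module Defs where

open import Data.Integer using (ℤ; +_; -[1+_]; _+_; _-_; _*_; -_; ∣_∣; _≤_; _<_; 0ℤ; 1ℤ)
open import Data.Integer.Divisibility using (_∣_)
open import Data.Integer.GCD using (gcd)
open import Data.Nat using (ℕ; suc; zero)
open import Data.Product using (_×_)
open import Data.Sum using (_⊎_)
open import Relation.Binary.PropositionalEquality using (_≡_; _≢_)

sgn : ℤ → ℤ
sgn (+ zero)    = + 0
sgn (+ (suc _)) = + 1
sgn -[1+ _ ]    = - (+ 1)

-- ModInv a m x  :  "(a⁻¹)_m is defined and equals x", following the paper's
-- definition literally.  Defined requires a*m ≠ 0 and gcd(a,m) = 1.
--  * m > 1     : 1 ≤ x ≤ m - 1       and  a x ≡ 1 (mod m)
--  * m < -1    : m + 1 ≤ x ≤ -1      and  a x ≡ 1 (mod m)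
--  * |m| = 1   : x = ½|m|(sgn m - sgn a) + sgn a,
--                stated (equivalently, multiplying by 2 in ℤ) as
--                2x = |m|(sgn m - sgn a) + 2 sgn a
ModInv : ℤ → ℤ → ℤ → Set
ModInv a m x =
  (a * m ≢ 0ℤ) × (gcd a m ≡ 1ℤ) ×
  ( ((+ 1 < m) × (+ 1 ≤ x) × (x ≤ m - + 1) × (m ∣ (a * x - + 1)))
  ⊎ ((m < - (+ 1)) × (m + + 1 ≤ x) × (x ≤ - (+ 1)) × (m ∣ (a * x - + 1)))
  ⊎ ((∣ m ∣ ≡ 1) × (+ 2 * x ≡ (+ ∣ m ∣) * (sgn m - sgn a) + + 2 * sgn a)) )

-- If a z + m y = 1 + a m and y lies strictly between 0 and a, then z = (a⁻¹)_m: the identity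
-- is a Bézout relation, so gcd(a, m) = 1 and m ∣ a z - 1, and comparing a z with multiples of
-- a pins z to the interval the definition prescribes; a < 0 reduces to a > 0 by negating
-- everything. For x = (a⁻¹)_b and y = (b⁻¹)_a this criterion and uniqueness of the inverse give
-- a x + b y = 1 + a b, and the two formulas of the corollary are identities of the same shape,
-- with y and with a - y in the role of y.

module Submission where

open import Defs
open import Data.Empty using (⊥-elim)
open import Data.Integer using (ℤ; +_; _+_; _-_; _*_; ∣_∣; 0ℤ; 1ℤ)
open import Data.Integer.Base using (-_; -[1+_]; _≤_; _<_; +≤+; +<+; -<+; -<-; nonNegative)
open import Data.Integer.Divisibility using (_∣_)
import Data.Integer.Divisibility.Signed as Signed
open import Data.Integer.GCD using (gcd; gcd[i,j]∣i; gcd[i,j]∣j)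
open import Data.Integer.Properties
open import Data.Integer.Tactic.RingSolver using (solve)
open import Data.List.Base using ([]; _∷_)
import Data.Nat.Base as ℕ
import Data.Nat.Divisibility as ℕ
import Data.Nat.GCD as ℕ
import Data.Nat.Properties as ℕ
open import Data.Product using (_×_; _,_; proj₁; proj₂)
open import Data.Sum using (_⊎_; inj₁; inj₂; [_,_]′)
open import Relation.Binary.PropositionalEquality
  using (_≡_; _≢_; refl; sym; trans; cong; cong₂; subst; subst₂; module ≡-Reasoning)

-- Lets the ring solver use a hypothesis l = r: it only has to check lhs = rhs + (l - r).
≡-by-identity : ∀ {l r lhs rhs : ℤ} → l ≡ r → lhs ≡ rhs + (l - r) → lhs ≡ rhs
≡-by-identity {l} {r} {lhs} {rhs} l≡r eq = begin
  lhs            ≡⟨ eq ⟩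
  rhs + (l - r)  ≡⟨ cong (λ e → rhs + (e - r)) l≡r ⟩
  rhs + (r - r)  ≡⟨ cong (λ e → rhs + e) (+-inverseʳ r) ⟩
  rhs + 0ℤ       ≡⟨ +-identityʳ rhs ⟩
  rhs            ∎
  where open ≡-Reasoning

i<i+[1+p] : ∀ i {p} → 0ℤ ≤ p → i < i + (+ 1 + p)
i<i+[1+p] i 0≤p = subst (_< i + _) (+-identityʳ i)
  (+-monoʳ-< i (suc[i]≤j⇒i<j (+-monoʳ-≤ (+ 1) 0≤p)))

<-by-identity : ∀ {l r i j : ℤ} p → l ≡ r → 0ℤ ≤ p → j ≡ i + (+ 1 + p) + (l - r) → i < j
<-by-identity {i = i} p l≡r 0≤p eq = subst (i <_) (sym (≡-by-identity l≡r eq)) (i<i+[1+p] i 0≤p)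

0≤i*j : ∀ {i j} → 0ℤ ≤ i → 0ℤ ≤ j → 0ℤ ≤ i * j
0≤i*j {i} {j} 0≤i 0≤j = subst (_≤ i * j) (*-zeroʳ i) (*-monoˡ-≤-nonNeg i {{nonNegative 0≤i}} 0≤j)

1<i⇒0≤i-2 : ∀ {i} → + 1 < i → 0ℤ ≤ i - + 2
1<i⇒0≤i-2 1<i = i≤j⇒0≤j-i (i<j⇒suc[i]≤j 1<i)

i≤j-1⇒i<j : ∀ {i j} → i ≤ j - + 1 → i < j
i≤j-1⇒i<j {i} {j} i≤j-1 = i≤pred[j]⇒i<j (subst (i ≤_) (+-comm j (- + 1)) i≤j-1)

i≢0∧j≢0⇒i*j≢0 : ∀ {i j} → i ≢ 0ℤ → j ≢ 0ℤ → i * j ≢ 0ℤ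
i≢0∧j≢0⇒i*j≢0 {i} i≢0 j≢0 eq = [ i≢0 , j≢0 ]′ (i*j≡0⇒i≡0∨j≡0 i eq)

i*j≡1⇒∣i∣≡1 : ∀ {i j} → i * j ≡ + 1 → ∣ i ∣ ≡ 1
i*j≡1⇒∣i∣≡1 {i} {j} eq = ℕ.m*n≡1⇒m≡1 ∣ i ∣ ∣ j ∣ (trans (sym (abs-* i j)) (cong ∣_∣ eq))

1<i⇒∣i∣≢1 : ∀ {i} → + 1 < i → ∣ i ∣ ≢ 1
1<i⇒∣i∣≢1 {+ ℕ.suc (ℕ.suc _)} _ ()
1<i⇒∣i∣≢1 {+ 1} (+<+ (ℕ.s≤s ()))
1<i⇒∣i∣≢1 {+ 0} (+<+ ())
1<i⇒∣i∣≢1 { -[1+ _ ]} ()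

InvPos InvNeg InvUnit : ℤ → ℤ → ℤ → Set
InvPos a m x = + 1 < m × + 1 ≤ x × x ≤ m - + 1 × m ∣ a * x - + 1
InvNeg a m x = m < - (+ 1) × m + + 1 ≤ x × x ≤ - (+ 1) × m ∣ a * x - + 1
InvUnit a m x = ∣ m ∣ ≡ 1 × + 2 * x ≡ + ∣ m ∣ * (sgn m - sgn a) + + 2 * sgn a

InRange : ℤ → ℤ → Set
InRange a y = (+ 1 < a × + 1 ≤ y × y ≤ a - + 1) ⊎ (a < - (+ 1) × a + + 1 ≤ y × y ≤ - (+ 1))

ModInv-inRange : ∀ {a m x} → ∣ m ∣ ≢ 1 → ModInv a m x → InRange m x × m ∣ a * x - + 1
ModInv-inRange _ (_ , _ , inj₁ (1<m , 1≤x , x≤m-1 , m∣ax-1)) = inj₁ (1<m , 1≤x , x≤m-1) , m∣ax-1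
ModInv-inRange _ (_ , _ , inj₂ (inj₁ (m<-1 , m+1≤x , x≤-1 , m∣ax-1))) = inj₂ (m<-1 , m+1≤x , x≤-1) , m∣ax-1
ModInv-inRange ∣m∣≢1 (_ , _ , inj₂ (inj₂ (∣m∣≡1 , _))) = ⊥-elim (∣m∣≢1 ∣m∣≡1)

InRange-reflect : ∀ {a y} → InRange a y → InRange a (a - y)
InRange-reflect {a} {y} (inj₁ (1<a , 1≤y , y≤a-1)) =
  inj₁ (1<a , subst (_≤ a - y) a-[a-1]≡1 (+-monoʳ-≤ a (neg-mono-≤ y≤a-1)) , +-monoʳ-≤ a (neg-mono-≤ 1≤y))
  where
  a-[a-1]≡1 : a - (a - + 1) ≡ + 1
  a-[a-1]≡1 = solve (a ∷ [])
InRange-reflect {a} {y} (inj₂ (a<-1 , a+1≤y , y≤-1)) =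
  inj₂ (a<-1 , +-monoʳ-≤ a (neg-mono-≤ y≤-1) , subst (a - y ≤_) a-[a+1]≡-1 (+-monoʳ-≤ a (neg-mono-≤ a+1≤y)))
  where
  a-[a+1]≡-1 : a - (a + + 1) ≡ - (+ 1)
  a-[a+1]≡-1 = solve (a ∷ [])

sgn-neg : ∀ i → sgn (- i) ≡ - sgn i
sgn-neg (+ ℕ.zero)  = refl
sgn-neg (+ ℕ.suc _) = refl
sgn-neg -[1+ _ ]    = refl

1<i⇒sgn[i]≡1 : ∀ {i} → + 1 < i → sgn i ≡ + 1
1<i⇒sgn[i]≡1 {+ ℕ.suc _} _ = refl
1<i⇒sgn[i]≡1 {+ 0} (+<+ ())
1<i⇒sgn[i]≡1 { -[1+ _ ]} ()

-i*-j≡i*j : ∀ i j → - i * - j ≡ i * j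
-i*-j≡i*j i j = solve (i ∷ j ∷ [])

gcd-neg : ∀ i j → gcd (- i) (- j) ≡ gcd i j
gcd-neg i j = cong₂ (λ m n → + ℕ.gcd m n) (∣-i∣≡∣i∣ i) (∣-i∣≡∣i∣ j)

∣ax-1-neg : ∀ {a m x} → m ∣ a * x - + 1 → - m ∣ - a * - x - + 1
∣ax-1-neg {a} {m} {x} m∣ax-1 =
  subst₂ ℕ._∣_ (sym (∣-i∣≡∣i∣ m)) (cong (λ e → ∣ e - + 1 ∣) (sym (-i*-j≡i*j a x))) m∣ax-1

InvPos-neg : ∀ {a m x} → InvPos a m x → InvNeg (- a) (- m) (- x)
InvPos-neg {a} {m} {x} (1<m , 1≤x , x≤m-1 , m∣ax-1) =
  neg-mono-< 1<m , subst (_≤ _) (neg-distrib-+ m (- (+ 1))) (neg-mono-≤ x≤m-1) , neg-mono-≤ 1≤x , ∣ax-1-neg {a} {m} {x} m∣ax-1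

InvNeg-neg : ∀ {a m x} → InvNeg a m x → InvPos (- a) (- m) (- x)
InvNeg-neg {a} {m} {x} (m<-1 , m+1≤x , x≤-1 , m∣ax-1) =
  neg-mono-< m<-1 , neg-mono-≤ x≤-1 , subst (_ ≤_) (neg-distrib-+ m (+ 1)) (neg-mono-≤ m+1≤x) , ∣ax-1-neg {a} {m} {x} m∣ax-1

InvUnit-neg : ∀ {a m x} → InvUnit a m x → InvUnit (- a) (- m) (- x)
InvUnit-neg {a} {m} {x} (∣m∣≡1 , eq) = trans (∣-i∣≡∣i∣ m) ∣m∣≡1 , (begin
  + 2 * - x                                        ≡⟨ neg-distribʳ-* (+ 2) x ⟨
  - (+ 2 * x)                                      ≡⟨ cong -_ eq ⟩
  - (+ ∣ m ∣ * (sgn m - sgn a) + + 2 * sgn a)      ≡⟨ negate (+ ∣ m ∣) (sgn m) (sgn a) ⟩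
  + ∣ m ∣ * (- sgn m - - sgn a) + + 2 * - sgn a    ≡⟨ cong₂ (λ s t → + ∣ m ∣ * (s - t) + + 2 * t) (sgn-neg m) (sgn-neg a) ⟨
  + ∣ m ∣ * (sgn (- m) - sgn (- a)) + + 2 * sgn (- a)  ≡⟨ cong (λ k → + k * (sgn (- m) - sgn (- a)) + + 2 * sgn (- a)) (∣-i∣≡∣i∣ m) ⟨
  + ∣ - m ∣ * (sgn (- m) - sgn (- a)) + + 2 * sgn (- a) ∎)
  where
  open ≡-Reasoning
  negate : ∀ k s t → - (k * (s - t) + + 2 * t) ≡ k * (- s - - t) + + 2 * - t
  negate k s t = solve (k ∷ s ∷ t ∷ [])

ModInv-neg : ∀ {a m x} → ModInv a m x → ModInv (- a) (- m) (- x)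
ModInv-neg {a} {m} (am≢0 , gcd≡1 , cases) =
  (λ eq → am≢0 (trans (sym (-i*-j≡i*j a m)) eq)) , trans (gcd-neg a m) gcd≡1 , negCases cases
  where
  negCases : ∀ {x : ℤ} → InvPos a m x ⊎ InvNeg a m x ⊎ InvUnit a m x →
             InvPos (- a) (- m) (- x) ⊎ InvNeg (- a) (- m) (- x) ⊎ InvUnit (- a) (- m) (- x)
  negCases (inj₁ pos)         = inj₂ (inj₁ (InvPos-neg {a} {m} pos))
  negCases (inj₂ (inj₁ neg))  = inj₁ (InvNeg-neg {a} {m} neg)
  negCases (inj₂ (inj₂ unit)) = inj₂ (inj₂ (InvUnit-neg {a} {m} unit))

ModInv-neg⁻¹ : ∀ {a m x} → ModInv (- a) (- m) (- x) → ModInv a m x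
ModInv-neg⁻¹ {a} {m} {x} h with ModInv-neg { - a} { - m} { - x} h
... | h′ rewrite neg-involutive a | neg-involutive m | neg-involutive x = h′

∣-inverse-difference : ∀ {a m x z} → m ∣ a * x - + 1 → m ∣ a * z - + 1 → m ∣ z - x
∣-inverse-difference {a} {m} {x} {z} m∣ax-1 m∣az-1 = Signed.∣⇒∣ᵤ (subst (Signed._∣_ m) combination
  (Signed.∣m∣n⇒∣m-n (Signed.∣n⇒∣m*n x (Signed.∣ᵤ⇒∣ {m} m∣az-1)) (Signed.∣n⇒∣m*n z (Signed.∣ᵤ⇒∣ {m} m∣ax-1))))
  where
  combination : x * (a * z - + 1) - z * (a * x - + 1) ≡ z - x
  combination = solve (a ∷ x ∷ z ∷ [])

∣∧∣d∣<∣m∣⇒d≡0 : ∀ {m d} → m ∣ d → ∣ d ∣ ℕ.< ∣ m ∣ → d ≡ 0ℤ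
∣∧∣d∣<∣m∣⇒d≡0 {d = d} m∣d d<m with ∣ d ∣ in ∣d∣≡n
... | ℕ.zero  = ∣i∣≡0⇒i≡0 ∣d∣≡n
... | ℕ.suc _ = ⊥-elim (ℕ.>⇒∤ d<m m∣d)

∣i-j∣<∣k∣ : ∀ {i j k} → 0ℤ ≤ i → i < k → 0ℤ ≤ j → j < k → ∣ i - j ∣ ℕ.< ∣ k ∣
∣i-j∣<∣k∣ {+ i} {+ j} {+ k} _ (+<+ i<k) _ (+<+ j<k) =
  ℕ.≤-<-trans (subst (ℕ._≤ i ℕ.⊔ j) (cong ∣_∣ (sym (m-n≡m⊖n i j))) (∣m⊝n∣≤m⊔n i j)) (ℕ.⊔-lub i<k j<k)

InvPos-unique : ∀ {a m x z} → InvPos a m x → InvPos a m z → x ≡ z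
InvPos-unique {a} {m} {x} {z} (_ , 1≤x , x≤m-1 , m∣ax-1) (_ , 1≤z , z≤m-1 , m∣az-1) =
  sym (i-j≡0⇒i≡j z x (∣∧∣d∣<∣m∣⇒d≡0 {m} (∣-inverse-difference {a} {m} {x} m∣ax-1 m∣az-1)
    (∣i-j∣<∣k∣ {k = m} (≤-trans (+≤+ ℕ.z≤n) 1≤z) (i≤j-1⇒i<j z≤m-1) (≤-trans (+≤+ ℕ.z≤n) 1≤x) (i≤j-1⇒i<j x≤m-1))))

InvUnit-unique : ∀ {a m x z} → InvUnit a m x → InvUnit a m z → x ≡ z
InvUnit-unique {x = x} {z} (_ , 2x≡) (_ , 2z≡) = *-cancelˡ-≡ (+ 2) x z (trans 2x≡ (sym 2z≡))

ModInv-unique : ∀ {a m x z} → ModInv a m x → ModInv a m z → x ≡ z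
ModInv-unique {a} {m} (_ , _ , cx) (_ , _ , cz) = unique cx cz
  where
  unique : ∀ {x z} → InvPos a m x ⊎ InvNeg a m x ⊎ InvUnit a m x →
           InvPos a m z ⊎ InvNeg a m z ⊎ InvUnit a m z → x ≡ z
  unique (inj₁ px)         (inj₁ pz)         = InvPos-unique {a} px pz
  unique (inj₂ (inj₁ nx))  (inj₂ (inj₁ nz))  = neg-injective (InvPos-unique { - a} (InvNeg-neg {a} {m} nx) (InvNeg-neg {a} {m} nz))
  unique (inj₂ (inj₂ ux))  (inj₂ (inj₂ uz))  = InvUnit-unique {a} {m} ux uz
  unique (inj₁ px)         (inj₂ (inj₁ nz))  = ⊥-elim (<-asym (proj₁ px) (<-trans (proj₁ nz) -<+))
  unique (inj₂ (inj₁ nx))  (inj₁ pz)         = ⊥-elim (<-asym (proj₁ pz) (<-trans (proj₁ nx) -<+))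
  unique (inj₁ px)         (inj₂ (inj₂ uz))  = ⊥-elim (1<i⇒∣i∣≢1 (proj₁ px) (proj₁ uz))
  unique (inj₂ (inj₂ ux))  (inj₁ pz)         = ⊥-elim (1<i⇒∣i∣≢1 (proj₁ pz) (proj₁ ux))
  unique (inj₂ (inj₁ nx))  (inj₂ (inj₂ uz))  = ⊥-elim (1<i⇒∣i∣≢1 (neg-mono-< (proj₁ nx)) (trans (∣-i∣≡∣i∣ m) (proj₁ uz)))
  unique (inj₂ (inj₂ ux))  (inj₂ (inj₁ nz))  = ⊥-elim (1<i⇒∣i∣≢1 (neg-mono-< (proj₁ nz)) (trans (∣-i∣≡∣i∣ m) (proj₁ ux)))

Bézout⇒gcd≡1 : ∀ {i j} u v → i * u + j * v ≡ + 1 → gcd i j ≡ 1ℤ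
Bézout⇒gcd≡1 {i} {j} u v eq = cong +_ (ℕ.∣1⇒≡1 (Signed.∣⇒∣ᵤ (subst (Signed._∣_ (gcd i j)) eq
  (Signed.∣m∣n⇒∣m+n (Signed.∣m⇒∣m*n {gcd i j} {i} u (Signed.∣ᵤ⇒∣ {gcd i j} (gcd[i,j]∣i i j)))
                    (Signed.∣m⇒∣m*n {gcd i j} {j} v (Signed.∣ᵤ⇒∣ {gcd i j} (gcd[i,j]∣j i j)))))))

-- For a > 1 and 1 ≤ y ≤ a - 1, every bound on z below is  a l < a z  or  a z < a u  with the
-- difference equal, modulo the identity, to 1 + p for an evidently nonnegative polynomial p.
module _ {a y : ℤ} (1<a : + 1 < a) (1≤y : + 1 ≤ y) (y≤a-1 : y ≤ a - + 1) where

  private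
    0≤y : 0ℤ ≤ y
    0≤y = ≤-trans (+≤+ ℕ.z≤n) 1≤y

    0≤y-1 : 0ℤ ≤ y - + 1
    0≤y-1 = i≤j⇒0≤j-i 1≤y

    0≤a-1-y : 0ℤ ≤ a - + 1 - y
    0≤a-1-y = i≤j⇒0≤j-i y≤a-1

    0≤a-y : 0ℤ ≤ a - y
    0≤a-y = i≤j⇒0≤j-i (≤-trans y≤a-1 (i-j≤i a (+ 1)))

    0≤a-1 : 0ℤ ≤ a - + 1
    0≤a-1 = i≤j⇒0≤j-i (<⇒≤ 1<a)

    *-cancel : ∀ {i j} → a * i < a * j → i < j
    *-cancel = *-cancelˡ-<-nonNeg a {{nonNegative (<⇒≤ (<-trans (+<+ (ℕ.s≤s ℕ.z≤n)) 1<a))}}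

  bounds-large : ∀ {m z} → a * z + m * y ≡ + 1 + a * m → + 1 < m → 0ℤ < z × z < m
  bounds-large {m} {z} identity 1<m =
    *-cancel (<-by-identity (m * (a - + 1 - y) + m) identity
      (+-mono-≤ (0≤i*j 0≤m 0≤a-1-y) 0≤m) (solve (a ∷ m ∷ y ∷ z ∷ []))) ,
    *-cancel (<-by-identity (m * (y - + 1) + (m - + 2)) (sym identity)
      (+-mono-≤ (0≤i*j 0≤m 0≤y-1) (1<i⇒0≤i-2 1<m)) (solve (a ∷ m ∷ y ∷ z ∷ [])))
    where
    0≤m : 0ℤ ≤ m
    0≤m = <⇒≤ (<-trans (+<+ (ℕ.s≤s ℕ.z≤n)) 1<m)

  bounds-small : ∀ {m z} → a * z + m * y ≡ + 1 + a * m → m < - (+ 1) → m < z × z < 0ℤ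
  bounds-small {m} {z} identity m<-1 =
    *-cancel (<-by-identity (- m * y) identity
      (0≤i*j 0≤-m 0≤y) (solve (a ∷ m ∷ y ∷ z ∷ []))) ,
    *-cancel (<-by-identity (- m * (a - + 1 - y) + (- m - + 2)) (sym identity)
      (+-mono-≤ (0≤i*j 0≤-m 0≤a-1-y) (1<i⇒0≤i-2 1<-m)) (solve (a ∷ m ∷ y ∷ z ∷ [])))
    where
    1<-m : + 1 < - m
    1<-m = neg-mono-< m<-1
    0≤-m : 0ℤ ≤ - m
    0≤-m = <⇒≤ (<-trans (+<+ (ℕ.s≤s ℕ.z≤n)) 1<-m)

  bounds-one : ∀ {z} → a * z + + 1 * y ≡ + 1 + a * + 1 → 0ℤ < z × z < + 2
  bounds-one {z} identity =
    *-cancel (<-by-identity (a - y) identity 0≤a-y (solve (a ∷ y ∷ z ∷ []))) ,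
    *-cancel (<-by-identity (a - + 1 + (y - + 1)) (sym identity)
      (+-mono-≤ 0≤a-1 0≤y-1) (solve (a ∷ y ∷ z ∷ [])))

  bounds-minus-one : ∀ {z} → a * z + - (+ 1) * y ≡ + 1 + a * - (+ 1) → - (+ 1) < z × z < + 1
  bounds-minus-one {z} identity =
    *-cancel (<-by-identity y identity 0≤y (solve (a ∷ y ∷ z ∷ []))) ,
    *-cancel (<-by-identity (a - + 1 - y + (a - + 1)) (sym identity)
      (+-mono-≤ 0≤a-1-y 0≤a-1) (solve (a ∷ y ∷ z ∷ [])))

identity⇒∣ : ∀ {a m y z} → a * z + m * y ≡ + 1 + a * m → m ∣ a * z - + 1
identity⇒∣ {a} {m} {y} {z} identity =
  Signed.∣⇒∣ᵤ {m} {a * z - + 1} (Signed.divides (a - y) (≡-by-identity identity (solve (a ∷ m ∷ y ∷ z ∷ []))))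

identity⇒m≢0 : ∀ {a m y z} → ∣ a ∣ ≢ 1 → a * z + m * y ≡ + 1 + a * m → m ≢ 0ℤ
identity⇒m≢0 {a} {y = y} {z} ∣a∣≢1 identity refl =
  ∣a∣≢1 (i*j≡1⇒∣i∣≡1 {a} {z} (≡-by-identity identity (solve (a ∷ y ∷ z ∷ []))))

InvCases-of-identity⁺ : ∀ {a y z} m → + 1 < a → + 1 ≤ y → y ≤ a - + 1 → a * z + m * y ≡ + 1 + a * m →
                        InvPos a m z ⊎ InvNeg a m z ⊎ InvUnit a m z
InvCases-of-identity⁺ {a} {y} {z} (+ 0) 1<a _ _ identity =
  ⊥-elim (identity⇒m≢0 {a} {+ 0} {y} {z} (1<i⇒∣i∣≢1 1<a) identity refl)
InvCases-of-identity⁺ {a} {y} {z} m@(+ ℕ.suc (ℕ.suc _)) 1<a 1≤y y≤a-1 identity =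
  inj₁ (1<m , i<j⇒suc[i]≤j (proj₁ bounds) , i<j⇒i≤pred[j] (proj₂ bounds) , identity⇒∣ {a} {m} {y} identity)
  where
  1<m : + 1 < m
  1<m = +<+ (ℕ.s≤s (ℕ.s≤s ℕ.z≤n))
  bounds : 0ℤ < z × z < m
  bounds = bounds-large 1<a 1≤y y≤a-1 identity 1<m
InvCases-of-identity⁺ {a} {y} {z} (+ 1) 1<a 1≤y y≤a-1 identity = inj₂ (inj₂ (refl , formula))
  where
  bounds : 0ℤ < z × z < + 2
  bounds = bounds-one 1<a 1≤y y≤a-1 identity
  z≡1 : z ≡ + 1
  z≡1 = ≤-antisym (i<j⇒i≤pred[j] (proj₂ bounds)) (i<j⇒suc[i]≤j (proj₁ bounds))
  formula : + 2 * z ≡ + 1 * (+ 1 - sgn a) + + 2 * sgn a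
  formula rewrite z≡1 | 1<i⇒sgn[i]≡1 1<a = refl
InvCases-of-identity⁺ {a} {y} {z} (-[1+ 0 ]) 1<a 1≤y y≤a-1 identity = inj₂ (inj₂ (refl , formula))
  where
  bounds : - (+ 1) < z × z < + 1
  bounds = bounds-minus-one 1<a 1≤y y≤a-1 identity
  z≡0 : z ≡ 0ℤ
  z≡0 = ≤-antisym (i<j⇒i≤pred[j] (proj₂ bounds)) (i<j⇒suc[i]≤j (proj₁ bounds))
  formula : + 2 * z ≡ + 1 * (- (+ 1) - sgn a) + + 2 * sgn a
  formula rewrite z≡0 | 1<i⇒sgn[i]≡1 1<a = refl
InvCases-of-identity⁺ {a} {y} {z} m@(-[1+ ℕ.suc _ ]) 1<a 1≤y y≤a-1 identity =
  inj₂ (inj₁ (m<-1 , i<j⇒suc[i]≤j (proj₁ bounds) , i<j⇒i≤pred[j] (proj₂ bounds) , identity⇒∣ {a} {m} {y} identity))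
  where
  m<-1 : m < - (+ 1)
  m<-1 = -<- (ℕ.s≤s ℕ.z≤n)
  bounds : m < z × z < 0ℤ
  bounds = bounds-small 1<a 1≤y y≤a-1 identity m<-1

ModInv-of-identity⁺ : ∀ {a m y z} → + 1 < a → + 1 ≤ y → y ≤ a - + 1 →
                      a * z + m * y ≡ + 1 + a * m → ModInv a m z
ModInv-of-identity⁺ {a} {m} {y} {z} 1<a 1≤y y≤a-1 identity =
  i≢0∧j≢0⇒i*j≢0 {a} {m} a≢0 (identity⇒m≢0 {a} {m} {y} {z} (1<i⇒∣i∣≢1 1<a) identity) ,
  Bézout⇒gcd≡1 {a} {m} (z - m) y (≡-by-identity identity (solve (a ∷ m ∷ y ∷ z ∷ []))) ,
  InvCases-of-identity⁺ m 1<a 1≤y y≤a-1 identity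
  where
  a≢0 : a ≢ 0ℤ
  a≢0 a≡0 = >-irrefl a≡0 (<-trans (+<+ (ℕ.s≤s ℕ.z≤n)) 1<a)

ModInv-of-identity : ∀ {a m y z} → InRange a y → a * z + m * y ≡ + 1 + a * m → ModInv a m z
ModInv-of-identity (inj₁ (1<a , 1≤y , y≤a-1)) identity = ModInv-of-identity⁺ 1<a 1≤y y≤a-1 identity
ModInv-of-identity {a} {m} {y} {z} (inj₂ (a<-1 , a+1≤y , y≤-1)) identity =
  ModInv-neg⁻¹ {a} {m} {z} (ModInv-of-identity⁺ { - a} { - m} { - y} { - z} (neg-mono-< a<-1) (neg-mono-≤ y≤-1)
    (subst (_ ≤_) (neg-distrib-+ a (+ 1)) (neg-mono-≤ a+1≤y))
    (≡-by-identity identity (solve (a ∷ m ∷ y ∷ z ∷ []))))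

inverse-pair-identity : ∀ {a b x y} → ∣ a ∣ ≢ 1 → ModInv a b x → ModInv b a y → a * x + b * y ≡ + 1 + a * b
inverse-pair-identity {a} {b} {x} {y} ∣a∣≢1 hx hy =
  subst (λ t → a * t + b * y ≡ + 1 + a * b) (sym x≡b-q) identity
  where
  range×a∣by-1 : InRange a y × a ∣ b * y - + 1
  range×a∣by-1 = ModInv-inRange {b} {a} {y} ∣a∣≢1 hy
  open Signed._∣_ (Signed.∣ᵤ⇒∣ {a} {b * y - + 1} (proj₂ range×a∣by-1)) renaming (quotient to q; equality to by-1≡qa)
  identity : a * (b - q) + b * y ≡ + 1 + a * b
  identity = identity-of q by-1≡qa
    where
    identity-of : ∀ q → b * y - + 1 ≡ q * a → a * (b - q) + b * y ≡ + 1 + a * b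
    identity-of q eq = ≡-by-identity eq (solve (a ∷ b ∷ q ∷ y ∷ []))
  x≡b-q : x ≡ b - q
  x≡b-q = ModInv-unique {a} {b} hx (ModInv-of-identity (proj₁ range×a∣by-1) identity)

corollary4p2 : (a b k : ℤ) → a ≢ 0ℤ → ∣ a ∣ ≢ 1 → gcd a b ≡ 1ℤ →
    (x y : ℤ) → ModInv a b x → ModInv b a y →
    ModInv a (k * a + b) (k * (a - y) + x) × ModInv a (k * a - b) (k * y - (b - x))
-- a ≢ 0ℤ and gcd a b ≡ 1ℤ are already part of ModInv a b x.
corollary4p2 a b k _ ∣a∣≢1 _ x y hx hy =
  ModInv-of-identity range identity₊ , ModInv-of-identity (InRange-reflect range) identity₋
  where
  identity : a * x + b * y ≡ + 1 + a * b
  identity = inverse-pair-identity ∣a∣≢1 hx hy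
  identity₊ : a * (k * (a - y) + x) + (k * a + b) * y ≡ + 1 + a * (k * a + b)
  identity₊ = ≡-by-identity identity (solve (a ∷ b ∷ k ∷ x ∷ y ∷ []))
  identity₋ : a * (k * y - (b - x)) + (k * a - b) * (a - y) ≡ + 1 + a * (k * a - b)
  identity₋ = ≡-by-identity identity (solve (a ∷ b ∷ k ∷ x ∷ y ∷ []))
  range : InRange a y
  range = proj₁ (ModInv-inRange {b} {a} {y} ∣a∣≢1 hy)
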